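{- For edge label alphabet size $\sigma=1$, the maximum number of edges in a Wheeler graph with $n$ vertices is $\Theta(n)$.
   Context: A directed edge-labeled graph $G=(V,E)$ has edge set $E$ consisting of triples $(u,v,k)$ (a directed edge from $u$ to $v$ with label $k\in\{1,\dots,\sigma\}$; self-loops allowed, $E$ is a set so an identical labeled edge is not repeated). $G$ is a Wheeler graph if there is a total ordering $<_\pi$ of $V$ such that for any two edges $(u,v,k)$ and $(u',v',k')$: (i) $k<k'$ implies $v<_\pi v'$; (ii) $k=k'$ and $u<_\pi u'$ imply $v\leq_\pi v'$; and in addition every vertex of in-degree zero precedes every vertex of positive in-degree in $<_\pi$. -}

module Defs where

open import Data.Nat using (ℕ)
open import Data.Fin using (Fin; _<_; _≤_)
open import Data.Product using (Σ; ∃; _×_; _,_; proj₁)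
open import Data.List using (List; length)
open import Data.List.Membership.Propositional using (_∈_)
open import Data.List.Relation.Unary.Unique.Propositional using (Unique)
open import Relation.Binary.PropositionalEquality using (_≡_; _≢_)
open import Function.Definitions using (Injective)

-- A labeled edge (u , v , k): from u to v with label k; vertices Fin n, labels Fin σ
-- (label k ∈ {1..σ} is represented by Fin σ, order-preserving).
Edge : ℕ → ℕ → Set
Edge n σ = Fin n × Fin n × Fin σ

src : ∀ {n σ} → Edge n σ → Fin n
src (u , v , k) = u

tgt : ∀ {n σ} → Edge n σ → Fin n
tgt (u , v , k) = v

lab : ∀ {n σ} → Edge n σ → Fin σ
lab (u , v , k) = k

-- A directed edge-labeled graph on vertex set Fin n: a duplicate-free list of edges
-- (i.e. a finite set of labeled edges; self-loops allowed).
Graph : ℕ → ℕ → Set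
Graph n σ = Σ (List (Edge n σ)) Unique

edges : ∀ {n σ} → Graph n σ → List (Edge n σ)
edges = proj₁

numEdges : ∀ {n σ} → Graph n σ → ℕ
numEdges G = length (edges G)

InDegZero : ∀ {n σ} → Graph n σ → Fin n → Set
InDegZero G x = ∀ e → e ∈ edges G → tgt e ≢ x

InDegPos : ∀ {n σ} → Graph n σ → Fin n → Set
InDegPos G x = ∃ λ e → e ∈ edges G × tgt e ≡ x

-- A total order on the vertices is given by an injective rank map π : Fin n → Fin n
-- (x <π y iff π x < π y).
IsWheelerOrder : ∀ {n σ} → Graph n σ → (Fin n → Fin n) → Set
IsWheelerOrder {n} G π =
  Injective _≡_ _≡_ π
  × (∀ e e' → e ∈ edges G → e' ∈ edges G →
       lab e < lab e' → π (tgt e) < π (tgt e'))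
  × (∀ e e' → e ∈ edges G → e' ∈ edges G →
       lab e ≡ lab e' → π (src e) < π (src e') → π (tgt e) ≤ π (tgt e'))
  × (∀ x y → InDegZero G x → InDegPos G y → π x < π y)

IsWheeler : ∀ {n σ} → Graph n σ → Set
IsWheeler {n} G = ∃ λ (π : Fin n → Fin n) → IsWheelerOrder G π

-- Lower bound: the n self-loops form a Wheeler graph under the identity order.
-- Upper bound: for edges with a common label, Wheeler condition (ii) says that a
-- strictly larger source rank forces a weakly larger target rank, so the sum of the
-- two ranks is injective on those edges; with σ = 1 this sum, which is below 2n,
-- is injective on all edges.
module Submission where

open import Defs
open import Data.Nat using (ℕ; _≤_; _*_)
open import Data.Product using (∃; _×_)

open import Data.Nat as ℕ using (_+_; _<_)
import Data.Nat.Properties as ℕ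
open import Data.Fin as Fin using (Fin; zero; suc; toℕ; fromℕ<)
import Data.Fin.Properties as Fin
open import Data.Product using (_,_; proj₁; proj₂)
open import Data.List using (List; length; lookup; tabulate)
open import Data.List.Properties using (length-tabulate)
open import Data.List.Membership.Propositional using (_∈_)
open import Data.List.Membership.Propositional.Properties using (∈-lookup; ∈-tabulate⁺; ∈-tabulate⁻)
open import Data.List.Relation.Unary.Unique.Propositional using (Unique)
open import Data.List.Relation.Unary.Unique.Propositional.Properties using (tabulate⁺)
open import Data.List.Relation.Unary.AllPairs using (_∷_)
import Data.List.Relation.Unary.All as All
open import Data.Empty using (⊥-elim)
open import Function.Definitions using (Injective)
open import Relation.Binary using (tri<; tri≈; tri>)
open import Relation.Binary.PropositionalEquality

lookup-injective : ∀ {A : Set} {xs : List A} → Unique xs → Injective _≡_ _≡_ (lookup xs)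
lookup-injective (_ ∷ _)      {zero}  {zero}  _  = refl
lookup-injective (x∉xs ∷ _)   {zero}  {suc j} eq = ⊥-elim (All.lookup x∉xs (∈-lookup j) eq)
lookup-injective (x∉xs ∷ _)   {suc i} {zero}  eq = ⊥-elim (All.lookup x∉xs (∈-lookup i) (sym eq))
lookup-injective (_ ∷ unique) {suc i} {suc j} eq = cong suc (lookup-injective unique eq)

length≤-if-injective-below : ∀ {A : Set} {xs : List A} {m : ℕ} (f : A → ℕ) → Unique xs →
  (∀ x → x ∈ xs → f x < m) →
  (∀ x y → x ∈ xs → y ∈ xs → f x ≡ f y → x ≡ y) →
  length xs ≤ m
length≤-if-injective-below {xs = xs} f unique f<m f-inj = Fin.injective⇒≤ g-injective
  where
  g : Fin (length xs) → Fin _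
  g i = fromℕ< (f<m (lookup xs i) (∈-lookup i))

  g-injective : Injective _≡_ _≡_ g
  g-injective {i} {j} eq = lookup-injective unique (f-inj _ _ (∈-lookup i) (∈-lookup j) (begin
    f (lookup xs i)  ≡⟨ Fin.toℕ-fromℕ< _ ⟨
    toℕ (g i)        ≡⟨ cong toℕ eq ⟩
    toℕ (g j)        ≡⟨ Fin.toℕ-fromℕ< _ ⟩
    f (lookup xs j)  ∎))
    where open ≡-Reasoning

selfLoops : (n : ℕ) → Graph n 1
selfLoops n = tabulate (λ i → i , i , zero) , tabulate⁺ (cong proj₁)

selfLoops-numEdges : ∀ n → numEdges (selfLoops n) ≡ n
selfLoops-numEdges n = length-tabulate _

selfLoops-isWheeler : ∀ n → IsWheeler (selfLoops n)
selfLoops-isWheeler n = (λ x → x) , (λ eq → eq) , label-order , source-order , sources-first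
  where
  label-order : ∀ e e' → e ∈ edges (selfLoops n) → e' ∈ edges (selfLoops n) →
    lab e Fin.< lab e' → tgt e Fin.< tgt e'
  label-order (_ , _ , zero) (_ , _ , zero) _ _ ()

  source-order : ∀ e e' → e ∈ edges (selfLoops n) → e' ∈ edges (selfLoops n) →
    lab e ≡ lab e' → src e Fin.< src e' → tgt e Fin.≤ tgt e'
  source-order e e' e∈ e'∈ _ src< with ∈-tabulate⁻ e∈ | ∈-tabulate⁻ e'∈
  ... | _ , refl | _ , refl = ℕ.<⇒≤ src<

  sources-first : ∀ x y → InDegZero (selfLoops n) x → InDegPos (selfLoops n) y → x Fin.< y
  sources-first x _ x-unreached _ = ⊥-elim (x-unreached (x , x , zero) (∈-tabulate⁺ x) refl)

rankSum : ∀ {n σ} → (Fin n → Fin n) → Edge n σ → ℕ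
rankSum π e = toℕ (π (src e)) + toℕ (π (tgt e))

rankSum<2n : ∀ {n σ} (π : Fin n → Fin n) (e : Edge n σ) → rankSum π e < n + n
rankSum<2n π (u , v , _) = ℕ.+-mono-<-≤ (Fin.toℕ<n (π u)) (ℕ.<⇒≤ (Fin.toℕ<n (π v)))

rankSum-injective-sameLabel : ∀ {n σ} (G : Graph n σ) (π : Fin n → Fin n) →
  IsWheelerOrder G π → ∀ e e' → e ∈ edges G → e' ∈ edges G →
  lab e ≡ lab e' → rankSum π e ≡ rankSum π e' → e ≡ e'
rankSum-injective-sameLabel _ π (π-inj , _ , source-order , _)
  e@(u , v , k) e'@(u' , v' , k') e∈ e'∈ k≡k' sum≡
  with ℕ.<-cmp (toℕ (π u)) (toℕ (π u'))
... | tri< πu<πu' _ _ =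
  ⊥-elim (ℕ.<⇒≢ (ℕ.+-mono-<-≤ πu<πu' (source-order e e' e∈ e'∈ k≡k' πu<πu')) sum≡)
... | tri> _ _ πu'<πu =
  ⊥-elim (ℕ.<⇒≢ (ℕ.+-mono-<-≤ πu'<πu (source-order e' e e'∈ e∈ (sym k≡k') πu'<πu)) (sym sum≡))
... | tri≈ _ πu≡πu' _ with π-inj (Fin.toℕ-injective πu≡πu') | k≡k'
... | refl | refl =
  cong (λ w → u , w , k) (π-inj (Fin.toℕ-injective (ℕ.+-cancelˡ-≡ (toℕ (π u)) _ _ sum≡)))

unlabelled-wheeler-numEdges≤2n : ∀ {n} (G : Graph n 1) → IsWheeler G → numEdges G ≤ 2 * n
unlabelled-wheeler-numEdges≤2n {n} G (π , wheeler) =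
  subst (numEdges G ≤_) (cong (n +_) (sym (ℕ.+-identityʳ n)))
    (length≤-if-injective-below (rankSum π) (proj₂ G) (λ e _ → rankSum<2n π e)
      (λ e e' e∈ e'∈ → rankSum-injective-sameLabel G π wheeler e e' e∈ e'∈ (single-label e e')))
  where
  single-label : ∀ (e e' : Edge n 1) → lab e ≡ lab e'
  single-label (_ , _ , zero) (_ , _ , zero) = refl

theorem5 : ∃ λ (a : ℕ) → ∃ λ (b : ℕ) → ∃ λ (N : ℕ) → ∀ (n : ℕ) → N ≤ n →
    (∃ λ (G : Graph n 1) → IsWheeler G × n ≤ a * numEdges G)
    × (∀ (G : Graph n 1) → IsWheeler G → numEdges G ≤ b * n)
theorem5 = 1 , 2 , 0 , λ n _ →
  ( selfLoops n
  , selfLoops-isWheeler n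
  , ℕ.≤-reflexive (sym (trans (ℕ.*-identityˡ _) (selfLoops-numEdges n))) )
  , unlabelled-wheeler-numEdges≤2n
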